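{- Let $\Sigma$ be the set of all nonempty even-grounded square-free words (finite or infinite). Let $\phi$ be a non-erasing morphism satisfying: (1) for all $w\in\Sigma$, $\phi(w)$ is square-free; (2) $\phi(0)$ generates $\phi(01)$; (3) $\phi(0n)$ generates $\phi(0n0)$ for all letters $n>0$; (4) $\phi(0n)^+$ generates $\phi(0\,(n+1))$ for all letters $n>0$. Then $\phi$ is $L$-commuting over $\Sigma$, i.e. $L(\phi(w))=\phi(L(w))$ for all $w\in\Sigma$.
   Context: Words are over $\mathbb{N}=\{0,1,2,\dots\}$, positions indexed from $0$. A square is a nonempty word $yy$; square-free means no square factor. A word $w=w_0w_1\cdots$ is even-grounded if $w_i=0$ for all even $i$ and $w_i\ne0$ for all odd $i$. For a nonempty finite word $w$, $w^+$ is $w$ with its last letter increased by $1$. For words $u,v$, $u\prec v$ means there is $i$ with $u[:i]=v[:i]$ and $u[i]<v[i]$. For a finite word $w$, $L(w)$ is the lexicographically least infinite word over $\mathbb{N}$ beginning with $w$ whose only square factors are contained in the prefix $w$; for infinite $w$, $L(w)=w$. A word $p$ generates a word $ps$ if $L(p)=L(ps)$. A morphism $\phi$ on $\mathbb{N}^*\cup\mathbb{N}^\omega$ is non-erasing if $\phi(k)$ is nonempty for every letter $k$. -}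

module Defs where

open import Data.Nat using (ℕ; zero; suc; _+_; _*_; _≤_; _<_)
open import Data.List using (List; []; _∷_; _++_; length; concatMap)
open import Data.List.NonEmpty using (List⁺; _∷_; toList)
open import Data.Product using (Σ; ∃; _×_; _,_)
open import Data.Sum using (_⊎_; inj₁; inj₂)
open import Data.Unit using (⊤)
open import Relation.Nullary using (¬_)
open import Relation.Binary.PropositionalEquality using (_≡_; _≢_)

-- Finite words: List ℕ.  Infinite words: functions ℕ → ℕ (position i ↦ letter).
Word∞ : Set
Word∞ = ℕ → ℕ

Word : Set
Word = List ℕ ⊎ Word∞

Prefix : List ℕ → Word∞ → Set
Prefix []      x = ⊤
Prefix (c ∷ p) x = (x 0 ≡ c) × Prefix p (λ i → x (suc i))

SquareFreeL : List ℕ → Set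
SquareFreeL w = ¬ (Σ (List ℕ) λ a → Σ (List ℕ) λ y → Σ (List ℕ) λ b →
                     (y ≢ []) × (w ≡ a ++ y ++ y ++ b))

SquareFree∞ : Word∞ → Set
SquareFree∞ x = ¬ (Σ (List ℕ) λ a → Σ (List ℕ) λ y →
                     (y ≢ []) × Prefix (a ++ y ++ y) x)

SquareFree : Word → Set
SquareFree (inj₁ w) = SquareFreeL w
SquareFree (inj₂ x) = SquareFree∞ x

mutual
  EvenGroundedL : List ℕ → Set
  EvenGroundedL []      = ⊤
  EvenGroundedL (c ∷ w) = (c ≡ 0) × OddGroundedL w

  OddGroundedL : List ℕ → Set
  OddGroundedL []      = ⊤
  OddGroundedL (c ∷ w) = (c ≢ 0) × EvenGroundedL w

EvenGrounded∞ : Word∞ → Set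
EvenGrounded∞ x = ∀ k → (x (2 * k) ≡ 0) × (x (suc (2 * k)) ≢ 0)

InΣ : Word → Set
InΣ (inj₁ w) = (w ≢ []) × EvenGroundedL w × SquareFreeL w
InΣ (inj₂ x) = EvenGrounded∞ x × SquareFree∞ x

-- w⁺ : last letter increased by one (only used for nonempty w)

_⁺ : List ℕ → List ℕ
[]           ⁺ = []
(c ∷ [])     ⁺ = suc c ∷ []
(c ∷ d ∷ w)  ⁺ = c ∷ ((d ∷ w) ⁺)

_≺_ : Word∞ → Word∞ → Set
u ≺ v = ∃ λ i → (∀ j → j < i → u j ≡ v j) × (u i < v i)

OnlySquaresIn : List ℕ → Word∞ → Set
OnlySquaresIn w z = ∀ a y → y ≢ [] → Prefix (a ++ y ++ y) z →
                    length (a ++ y ++ y) ≤ length w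

Admissible : List ℕ → Word∞ → Set
Admissible w z = Prefix w z × OnlySquaresIn w z

IsL : Word → Word∞ → Set
IsL (inj₁ w) x = Admissible w x × (∀ z → Admissible w z → ¬ (z ≺ x))
IsL (inj₂ y) x = ∀ i → y i ≡ x i

Generates : List ℕ → List ℕ → Set
Generates p q = (∃ λ s → q ≡ p ++ s) × (∀ x → IsL (inj₁ p) x → IsL (inj₁ q) x)

-- Non-erasing morphisms: each letter is sent to a nonempty word

Morphism : Set
Morphism = ℕ → List⁺ ℕ

apply* : Morphism → List ℕ → List ℕ
apply* φ = concatMap (λ k → toList (φ k))

-- image of an infinite word: letter i of φ(x0) φ(x1) φ(x2) ...
-- go i h t x : letter i of (h ∷ t) ++ φ(x 0) φ(x 1) ...
private
  go : Morphism → ℕ → ℕ → List ℕ → Word∞ → ℕ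
  go φ zero    h t       x = h
  go φ (suc i) h (c ∷ t) x = go φ i c t x
  go φ (suc i) h []      x with φ (x 0)
  ... | h' ∷ t' = go φ i h' t' (λ j → x (suc j))

apply∞ : Morphism → Word∞ → Word∞
apply∞ φ x i with φ (x 0)
... | h ∷ t = go φ i h t (λ j → x (suc j))

applyW : Morphism → Word → Word
applyW φ (inj₁ w) = inj₁ (apply* φ w)
applyW φ (inj₂ x) = inj₂ (apply∞ φ x)

module Submission where

-- L(w) is the greedy continuation of w: past the prefix w each letter is the least one that
-- closes no square, and conversely an admissible word that is greedy past w is the least one.
-- For w ∈ Σ this continuation x is square-free and even-grounded, since appending 0 to a
-- square-free even-grounded word of even length never closes a square.  So φ(x) is square-free,
-- hence admissible for φ(w), and it remains to see that it is greedy past φ(w), one block φ(x k)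
-- at a time.  A block φ(0) following φ(t 0 n) is greedy by (3).  A block φ(n+1) following φ(t 0)
-- is greedy by induction on n: by (4), φ(n+2) = A (c+1) s where φ(n+1) = A c, and the letter c is
-- excluded because t 0 (n+1), which ends in a square since x is greedy, maps to φ(t 0) A c.

open import Defs
open import Data.Nat using (ℕ; zero; suc; _≤_; _<_; z≤n; s≤s; z<s; s<s; _≟_; _<?_; _≤?_)
open import Data.Nat.Properties
open import Data.List using (List; []; [_]; _∷_; _++_; _∷ʳ_; length; applyUpTo; initLast; _∷ʳ′_)
open import Data.List.Properties using (++-assoc; ++-identityʳ; ++-cancelˡ; ++-conicalˡ; ∷ʳ-injective; ∷-injective; length-++; length-applyUpTo; applyUpTo-∷ʳ; concatMap-++; ≡-dec)
open import Data.List.NonEmpty as List⁺ using (_∷_; toList)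
open import Data.List.Relation.Unary.All as All using (All; []; _∷_)
open import Data.List.Relation.Unary.All.Properties using (++⁻ˡ; ++⁻ʳ)
open import Data.List.Extrema.Nat using (max; xs≤max)
open import Data.Product using (∃; ∃₂; _×_; _,_; proj₁; proj₂)
open import Data.Sum as Sum using (_⊎_; inj₁; inj₂)
open import Data.Unit using (⊤; tt)
open import Function using (_∘_)
open import Relation.Nullary using (¬_; Dec; yes; no; contradiction)
open import Relation.Nullary.Decidable using (decidable-stable; ¬?; _×-dec_; _⊎-dec_; map′)
open import Data.Nat.Induction using (<-rec)
open import Relation.Binary.PropositionalEquality hiding ([_])

variable
  x z : Word∞
  b′ p q u v w : List ℕ
  c e i j n : ℕ

prefix-applyUpTo : ∀ n (x : Word∞) → Prefix (applyUpTo x n) x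
prefix-applyUpTo zero    x = tt
prefix-applyUpTo (suc n) x = refl , prefix-applyUpTo n (x ∘ suc)

prefix⇒applyUpTo : ∀ v → Prefix v x → applyUpTo x (length v) ≡ v
prefix⇒applyUpTo []      _          = refl
prefix⇒applyUpTo (c ∷ v) (x₀ , pre) = cong₂ _∷_ x₀ (prefix⇒applyUpTo v pre)

applyUpTo⇒prefix : ∀ v → applyUpTo x (length v) ≡ v → Prefix v x
applyUpTo⇒prefix {x} v eq = subst (λ u → Prefix u x) eq (prefix-applyUpTo (length v) x)

prefix-++⁻ˡ : ∀ u → Prefix (u ++ v) x → Prefix u x
prefix-++⁻ˡ []      _          = tt
prefix-++⁻ˡ (c ∷ u) (x₀ , pre) = x₀ , prefix-++⁻ˡ u pre

prefix-agree : ∀ v → Prefix v x → Prefix v z → i < length v → x i ≡ z i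
prefix-agree {i = zero}  (c ∷ v) (x₀ , _) (z₀ , _) _ = trans x₀ (sym z₀)
prefix-agree {i = suc i} (c ∷ v) (_ , px) (_ , pz) (s≤s i<) = prefix-agree v px pz i<

prefix-at : ∀ u → Prefix (u ++ e ∷ v) x → x (length u) ≡ e
prefix-at []      (x₀ , _)   = x₀
prefix-at (c ∷ u) (_ , pre) = prefix-at u pre

prefix-extends : ∀ u w → Prefix u x → Prefix w x → length u ≤ length w → ∃ λ r → w ≡ u ++ r
prefix-extends []      w       _          _          _        = w , refl
prefix-extends (c ∷ u) (d ∷ w) (x₀ , pu) (x₀′ , pw) (s≤s le) with prefix-extends u w pu pw le
... | r , eq = r , cong₂ _∷_ (trans (sym x₀′) x₀) eq

applyUpTo-agree : ∀ n → (∀ j → j < n → x j ≡ z j) → applyUpTo x n ≡ applyUpTo z n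
applyUpTo-agree zero    _   = refl
applyUpTo-agree (suc n) agr = cong₂ _∷_ (agr 0 z<s) (applyUpTo-agree n (λ j j< → agr (suc j) (s<s j<)))

length-∷ʳ : ∀ v → length (v ∷ʳ c) ≡ suc (length v)
length-∷ʳ v = trans (length-++ v) (+-comm _ 1)

∷ʳ-view : ∀ v → v ≢ [] → ∃₂ λ u (c : ℕ) → v ≡ u ∷ʳ c
∷ʳ-view v v≢[] with initLast v
... | []      = contradiction refl v≢[]
... | u ∷ʳ′ c = u , c , refl

∷ʳ-⁺ : ∀ u → (u ∷ʳ c) ⁺ ≡ u ∷ʳ suc c
∷ʳ-⁺ []          = refl
∷ʳ-⁺ (d ∷ [])    = refl
∷ʳ-⁺ (d ∷ e ∷ u) = cong (d ∷_) (∷ʳ-⁺ (e ∷ u))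

-- Suffix squares

SuffixSquare : List ℕ → Set
SuffixSquare v = ∃₂ λ a y → y ≢ [] × v ≡ a ++ y ++ y

suffixSquare-++ˡ : ∀ u → SuffixSquare v → SuffixSquare (u ++ v)
suffixSquare-++ˡ u (a , y , y≢[] , refl) = u ++ a , y , y≢[] , sym (++-assoc u a _)

suffixSquare-∷ʳ⁻ : ∀ a y → y ≢ [] → v ∷ʳ c ≡ a ++ y ++ y → ∃ λ y₀ → y ≡ y₀ ∷ʳ c × v ≡ a ++ y ++ y₀
suffixSquare-∷ʳ⁻ {v} {c} a y y≢[] eq with ∷ʳ-view y y≢[]
... | y₀ , c′ , refl with ∷ʳ-injective v (a ++ (y₀ ∷ʳ c′) ++ y₀) (begin
      v ∷ʳ c                             ≡⟨ eq ⟩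
      a ++ (y₀ ∷ʳ c′) ++ y₀ ++ [ c′ ]      ≡⟨ cong (a ++_) (++-assoc (y₀ ∷ʳ c′) y₀ [ c′ ]) ⟨
      a ++ ((y₀ ∷ʳ c′) ++ y₀) ∷ʳ c′        ≡⟨ ++-assoc a _ [ c′ ] ⟨
      (a ++ (y₀ ∷ʳ c′) ++ y₀) ∷ʳ c′        ∎)
  where open ≡-Reasoning
... | v≡ , refl = y₀ , refl , v≡

suffixSquare-fresh : All (_< c) v → ¬ SuffixSquare (v ∷ʳ c)
suffixSquare-fresh {c} {v} below (a , y , y≢[] , eq) with suffixSquare-∷ʳ⁻ a y y≢[] eq
... | y₀ , refl , refl with ++⁻ʳ y₀ (++⁻ˡ (y₀ ∷ʳ c) (++⁻ʳ a below))
... | c<c ∷ [] = <-irrefl refl c<c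

Splits : (List ℕ → List ℕ → Set) → List ℕ → Set
Splits P v = ∃₂ λ y z → v ≡ y ++ z × P y z

splits? : {P : List ℕ → List ℕ → Set} → (∀ y z → Dec (P y z)) → ∀ v → Dec (Splits P v)
splits? P? [] = map′ (λ p → [] , [] , refl , p) (λ { ([] , [] , refl , p) → p }) (P? [] [])
splits? {P} P? (c ∷ v) = map′ to from (P? [] (c ∷ v) ⊎-dec splits? (λ y → P? (c ∷ y)) v)
  where
  to : P [] (c ∷ v) ⊎ Splits (P ∘ (c ∷_)) v → Splits P (c ∷ v)
  to (inj₁ p)                = [] , c ∷ v , refl , p
  to (inj₂ (y , z , eq , p)) = c ∷ y , z , cong (c ∷_) eq , p
  from : Splits P (c ∷ v) → P [] (c ∷ v) ⊎ Splits (P ∘ (c ∷_)) v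
  from ([] , z , refl , p)    = inj₁ p
  from (d ∷ y , z , eq , p) with ∷-injective eq
  ... | refl , eq′ = inj₂ (y , z , eq′ , p)

suffixSquare? : ∀ v → Dec (SuffixSquare v)
suffixSquare? = map′ to from ∘ splits? (λ _ → splits? λ y y′ → ≡-dec _≟_ y y′ ×-dec ¬? (≡-dec _≟_ y []))
  where
  to : Splits (λ _ → Splits λ y y′ → y ≡ y′ × y ≢ []) v → SuffixSquare v
  to (a , s , refl , y , y , refl , refl , y≢[]) = a , y , y≢[] , refl
  from : SuffixSquare v → Splits (λ _ → Splits λ y y′ → y ≡ y′ × y ≢ []) v
  from (a , y , y≢[] , refl) = a , y ++ y , refl , y , y , refl , refl , y≢[]

squareFree∞⇒¬suffixSquare : SquareFree∞ x → ¬ SuffixSquare (applyUpTo x n)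
squareFree∞⇒¬suffixSquare {x} {n} sf (a , y , y≢[] , eq) =
  sf (a , y , y≢[] , subst (λ u → Prefix u x) eq (prefix-applyUpTo n x))

leastWitness : {P : ℕ → Set} → (∀ n → Dec (P n)) → ∀ n → P n → ∃ λ d → P d × (∀ e → e < d → ¬ P e)
leastWitness {P} P? = <-rec (λ n → P n → ∃ λ d → P d × (∀ e → e < d → ¬ P e)) search
  where
  search : ∀ n → (∀ {m} → m < n → P m → ∃ λ d → P d × (∀ e → e < d → ¬ P e)) → P n →
           ∃ λ d → P d × (∀ e → e < d → ¬ P e)
  search n below pn with anyUpTo? P? n
  ... | yes (m , m<n , pm) = below m<n pm
  ... | no ∄               = n , pn , λ e e<n pe → ∄ (e , e<n , pe)

private
  safeLetter : ∀ v → ∃ λ d → ¬ SuffixSquare (v ∷ʳ d) × (∀ e → e < d → ¬ ¬ SuffixSquare (v ∷ʳ e))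
  safeLetter v = leastWitness (λ d → ¬? (suffixSquare? (v ∷ʳ d))) (suc (max 0 v))
                   (suffixSquare-fresh (All.map s≤s (xs≤max 0 v)))

safe : List ℕ → ℕ
safe v = proj₁ (safeLetter v)

safe-sound : ∀ v → ¬ SuffixSquare (v ∷ʳ safe v)
safe-sound v = proj₁ (proj₂ (safeLetter v))

safe-least : ∀ v → e < safe v → SuffixSquare (v ∷ʳ e)
safe-least {e} v e< = decidable-stable (suffixSquare? (v ∷ʳ e)) (proj₂ (proj₂ (safeLetter v)) e e<)

-- Greedy words and L(w)

Greedy : Word∞ → ℕ → Set
Greedy x j = ∀ d → d < x j → SuffixSquare (applyUpTo x j ∷ʳ d)

GreedyFrom : ℕ → Word∞ → Set
GreedyFrom n x = ∀ j → n ≤ j → Greedy x j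

onlySquaresIn⇒ : ∀ w → OnlySquaresIn w x → SuffixSquare (applyUpTo x n) → n ≤ length w
onlySquaresIn⇒ {x} {n} w only (a , y , y≢[] , eq) =
  subst (_≤ length w) len (only a y y≢[] (applyUpTo⇒prefix _ (trans (cong (applyUpTo x) len) eq)))
  where
  len : length (a ++ y ++ y) ≡ n
  len = trans (cong length (sym eq)) (length-applyUpTo x n)

⇒onlySquaresIn : ∀ w → (∀ n → SuffixSquare (applyUpTo x n) → n ≤ length w) → OnlySquaresIn w x
⇒onlySquaresIn w bound a y y≢[] pre = bound _ (a , y , y≢[] , prefix⇒applyUpTo _ pre)

greedy⇒least : Prefix p x → GreedyFrom (length p) x → ∀ z → Admissible p z → ¬ z ≺ x
greedy⇒least {p} {x} px x-greedy z (pz , onlyZ) (i , agree , zᵢ<xᵢ) with i <? length p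
... | yes i<p = <-irrefl (prefix-agree p pz px i<p) zᵢ<xᵢ
... | no  i≮p = i≮p (onlySquaresIn⇒ p onlyZ (subst SuffixSquare square (x-greedy i (≮⇒≥ i≮p) (z i) zᵢ<xᵢ)))
  where
  square : applyUpTo x i ∷ʳ z i ≡ applyUpTo z (suc i)
  square = trans (cong (_∷ʳ z i) (applyUpTo-agree i λ j j< → sym (agree j j<))) (applyUpTo-∷ʳ z i)

-- grow u r reads r and then continues greedily, u being the part already read.
grow : List ℕ → List ℕ → Word∞
grow u []      zero    = safe u
grow u []      (suc i) = grow (u ∷ʳ safe u) [] i
grow u (c ∷ r) zero    = c
grow u (c ∷ r) (suc i) = grow (u ∷ʳ c) r i

greedy : List ℕ → Word∞
greedy = grow []

prefix-grow : ∀ u r → Prefix r (grow u r)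
prefix-grow u []      = tt
prefix-grow u (c ∷ r) = refl , prefix-grow (u ∷ʳ c) r

grow-safe : ∀ u r → length r ≤ i → grow u r i ≡ safe (u ++ applyUpTo (grow u r) i)
grow-safe {zero}  u []      _        = cong safe (sym (++-identityʳ u))
grow-safe {suc i} u []      _        = trans (grow-safe (u ∷ʳ safe u) [] z≤n) (cong safe (++-assoc u _ _))
grow-safe {suc i} u (c ∷ r) (s≤s le) = trans (grow-safe (u ∷ʳ c) r le) (cong safe (++-assoc u _ _))

greedy-safe : ∀ v → length v ≤ j → ¬ SuffixSquare (applyUpTo (greedy v) (suc j))
greedy-safe {j} v le = subst (λ s → ¬ SuffixSquare s)
  (trans (cong (applyUpTo (greedy v) j ∷ʳ_) (sym (grow-safe [] v le))) (applyUpTo-∷ʳ (greedy v) j))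
  (safe-sound (applyUpTo (greedy v) j))

greedy-greedyFrom : ∀ v → GreedyFrom (length v) (greedy v)
greedy-greedyFrom v j le d d< = safe-least (applyUpTo (greedy v) j) (subst (d <_) (grow-safe [] v le) d<)

greedy-onlySquaresIn : ∀ v → OnlySquaresIn v (greedy v)
greedy-onlySquaresIn v = ⇒onlySquaresIn v bound
  where
  bound : ∀ n → SuffixSquare (applyUpTo (greedy v) n) → n ≤ length v
  bound zero    _  = z≤n
  bound (suc j) sq with j <? length v
  ... | yes j<v = j<v
  ... | no  j≮v = contradiction sq (greedy-safe v (≮⇒≥ j≮v))

greedy-isL : ∀ v → IsL (inj₁ v) (greedy v)
greedy-isL v = (prefix-grow [] v , greedy-onlySquaresIn v) ,
               greedy⇒least (prefix-grow [] v) (greedy-greedyFrom v)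

-- Were a smaller letter d admissible at position j ≥ |p|, the greedy continuation of x[0..j) d
-- would be an admissible word below x.
isL⇒greedyFrom : ∀ p → IsL (inj₁ p) x → GreedyFrom (length p) x
isL⇒greedyFrom {x} p ((px , onlyX) , least) j p≤j d d<xⱼ =
  decidable-stable (suffixSquare? xd) λ xd-safe → least y (admissible xd-safe) (j , agree , yⱼ<xⱼ)
  where
  xd : List ℕ
  xd = applyUpTo x j ∷ʳ d
  y : Word∞
  y = greedy xd
  yⱼ<xⱼ : y j < x j
  yⱼ<xⱼ = subst (_< x j) (sym (subst (λ m → y m ≡ d) (length-applyUpTo x j)
                                 (prefix-at (applyUpTo x j) (prefix-grow [] xd)))) d<xⱼ
  agree : ∀ i → i < j → y i ≡ x i
  agree i i<j = prefix-agree (applyUpTo x j) (prefix-++⁻ˡ _ (prefix-grow [] xd)) (prefix-applyUpTo j x)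
                  (subst (i <_) (sym (length-applyUpTo x j)) i<j)
  upTo-agree : n ≤ j → applyUpTo y n ≡ applyUpTo x n
  upTo-agree {n} n≤j = applyUpTo-agree n λ i i<n → agree i (<-≤-trans i<n n≤j)
  length-xd : length xd ≡ suc j
  length-xd = trans (length-∷ʳ (applyUpTo x j)) (cong suc (length-applyUpTo x j))
  admissible : ¬ SuffixSquare xd → Admissible p y
  admissible xd-safe = applyUpTo⇒prefix p (trans (upTo-agree p≤j) (prefix⇒applyUpTo p px)) ,
                      ⇒onlySquaresIn p bound
    where
    bound : ∀ n → SuffixSquare (applyUpTo y n) → n ≤ length p
    bound n sq with m≤n⇒m<n∨m≡n (subst (n ≤_) length-xd (onlySquaresIn⇒ xd (greedy-onlySquaresIn xd) sq))
    ... | inj₁ (s≤s n≤j) = onlySquaresIn⇒ p onlyX (subst SuffixSquare (upTo-agree n≤j) sq)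
    ... | inj₂ refl      = contradiction (subst SuffixSquare (prefix⇒applyUpTo xd (prefix-grow [] xd)) sq')
                                         xd-safe
      where
      sq' : SuffixSquare (applyUpTo y (length xd))
      sq' = subst (λ m → SuffixSquare (applyUpTo y m)) (sym length-xd) sq

admissible⇒squareFree∞ : SquareFreeL w → Admissible w x → SquareFree∞ x
admissible⇒squareFree∞ {w} w-sf (pw , only) (a , y , y≢[] , pre)
  with prefix-extends (a ++ y ++ y) w pre pw (only a y y≢[] pre)
... | r , refl = w-sf (a , y , r , y≢[] , trans (++-assoc a _ r) (cong (a ++_) (++-assoc y y r)))

-- Greedy blocks

GreedyAfter : List ℕ → List ℕ → Set
GreedyAfter u []      = ⊤
GreedyAfter u (e ∷ b) = (∀ d → d < e → SuffixSquare (u ∷ʳ d)) × GreedyAfter (u ∷ʳ e) b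

greedyAfter-++ˡ : ∀ u v b → GreedyAfter v b → GreedyAfter (u ++ v) b
greedyAfter-++ˡ u v []      _            = tt
greedyAfter-++ˡ u v (e ∷ b) (least , ga) =
  (λ d d<e → subst SuffixSquare (sym (++-assoc u v [ d ])) (suffixSquare-++ˡ u (least d d<e))) ,
  subst (λ w → GreedyAfter w b) (sym (++-assoc u v [ e ])) (greedyAfter-++ˡ u (v ∷ʳ e) b ga)

greedyAfter-++ : ∀ u b → GreedyAfter u b → GreedyAfter (u ++ b) b′ → GreedyAfter u (b ++ b′)
greedyAfter-++ {b′} u []      _            ga′ = subst (λ w → GreedyAfter w b′) (++-identityʳ u) ga′
greedyAfter-++ {b′} u (e ∷ b) (least , ga) ga′ =
  least , greedyAfter-++ (u ∷ʳ e) b ga (subst (λ w → GreedyAfter w b′) (sym (++-assoc u [ e ] b)) ga′)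

greedyAfter-++⁻ : ∀ u b → GreedyAfter u (b ++ b′) → GreedyAfter u b × GreedyAfter (u ++ b) b′
greedyAfter-++⁻ {b′} u []      ga = tt , subst (λ w → GreedyAfter w b′) (sym (++-identityʳ u)) ga
greedyAfter-++⁻ {b′} u (e ∷ b) (least , ga) with greedyAfter-++⁻ (u ∷ʳ e) b ga
... | ga₁ , ga₂ = (least , ga₁) , subst (λ w → GreedyAfter w b′) (++-assoc u [ e ] b) ga₂

greedyAfter-bump : ∀ u b → GreedyAfter u (b ∷ʳ e) → SuffixSquare ((u ++ b) ∷ʳ e) →
                   GreedyAfter u (b ∷ʳ suc e)
greedyAfter-bump {e} u b ga sq with greedyAfter-++⁻ u b ga
... | ga-b , (least , _) = greedyAfter-++ u b ga-b (least′ , tt)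
  where
  least′ : ∀ d → d < suc e → SuffixSquare ((u ++ b) ∷ʳ d)
  least′ d (s≤s d≤e) with m≤n⇒m<n∨m≡n d≤e
  ... | inj₁ d<e = least d d<e
  ... | inj₂ refl = sq

greedyAfter⇒greedy : ∀ u b → GreedyAfter u b → Prefix (u ++ b) x →
                     ∀ j → length u ≤ j → j < length (u ++ b) → Greedy x j
greedyAfter⇒greedy u [] _ _ j u≤j j<u =
  contradiction u≤j (<⇒≱ (subst (λ w → j < length w) (++-identityʳ u) j<u))
greedyAfter⇒greedy {x} u (e ∷ b) (least , ga) pre j u≤j j< with m≤n⇒m<n∨m≡n u≤j
... | inj₂ refl = λ d d<xⱼ →
  subst (λ w → SuffixSquare (w ∷ʳ d)) (sym (prefix⇒applyUpTo u (prefix-++⁻ˡ u pre)))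
        (least d (subst (d <_) (prefix-at u pre) d<xⱼ))
... | inj₁ u<j  = greedyAfter⇒greedy (u ∷ʳ e) b ga (subst (λ w → Prefix w x) u∷e≡ pre) j
                    (subst (_≤ j) (sym (length-∷ʳ u)) u<j) (subst (λ w → j < length w) u∷e≡ j<)
  where
  u∷e≡ : u ++ e ∷ b ≡ (u ∷ʳ e) ++ b
  u∷e≡ = sym (++-assoc u [ e ] b)

greedyFrom⇒greedyAfter : ∀ u b → Prefix (u ++ b) x → GreedyFrom (length u) x → GreedyAfter u b
greedyFrom⇒greedyAfter u []      _   _      = tt
greedyFrom⇒greedyAfter {x} u (e ∷ b) pre x-greedy =
  (λ d d<e → subst (λ w → SuffixSquare (w ∷ʳ d)) (prefix⇒applyUpTo u (prefix-++⁻ˡ u pre))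
               (x-greedy (length u) ≤-refl d (subst (d <_) (sym (prefix-at u pre)) d<e))) ,
  greedyFrom⇒greedyAfter (u ∷ʳ e) b (subst (λ w → Prefix w x) (sym (++-assoc u [ e ] b)) pre)
    (λ j le → x-greedy j (≤-trans (n≤1+n _) (subst (_≤ j) (length-∷ʳ u) le)))

generates⇒greedyAfter : ∀ p s → Generates p q → q ≡ p ++ s → GreedyAfter p s
generates⇒greedyAfter p s (_ , sameL) refl =
  greedyFrom⇒greedyAfter p s (proj₁ (proj₁ (sameL (greedy p) (greedy-isL p))))
    (isL⇒greedyFrom p (greedy-isL p))

-- Even-grounded words

mutual
  evenGroundedL-∷ʳ : ∀ v → EvenGroundedL v → EvenGroundedL (v ∷ʳ 0) ⊎ (∀ c → c ≢ 0 → EvenGroundedL (v ∷ʳ c))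
  evenGroundedL-∷ʳ []      _           = inj₁ (refl , tt)
  evenGroundedL-∷ʳ (d ∷ v) (d≡0 , odd) =
    Sum.map (d≡0 ,_) (λ nz c c≢0 → d≡0 , nz c c≢0) (oddGroundedL-∷ʳ v odd)

  oddGroundedL-∷ʳ : ∀ v → OddGroundedL v → OddGroundedL (v ∷ʳ 0) ⊎ (∀ c → c ≢ 0 → OddGroundedL (v ∷ʳ c))
  oddGroundedL-∷ʳ []      _            = inj₂ (λ c c≢0 → c≢0 , tt)
  oddGroundedL-∷ʳ (d ∷ v) (d≢0 , even) =
    Sum.map (d≢0 ,_) (λ nz c c≢0 → d≢0 , nz c c≢0) (evenGroundedL-∷ʳ v even)

evenGroundedL-++⁻ˡ : ∀ u → EvenGroundedL (u ++ v) → EvenGroundedL u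
evenGroundedL-++⁻ˡ []          _                 = tt
evenGroundedL-++⁻ˡ (d ∷ [])    (d≡0 , _)         = d≡0 , tt
evenGroundedL-++⁻ˡ (d ∷ e ∷ u) (d≡0 , e≢0 , rest) = d≡0 , e≢0 , evenGroundedL-++⁻ˡ u rest

evenGroundedL-after0 : ∀ p → EvenGroundedL (p ++ 0 ∷ c ∷ q) → c ≢ 0
evenGroundedL-after0 []          (_ , c≢0 , _)  = c≢0
evenGroundedL-after0 (d ∷ [])    (_ , 0≢0 , _)  = contradiction refl 0≢0
evenGroundedL-after0 (d ∷ e ∷ p) (_ , _ , rest) = evenGroundedL-after0 p rest

evenGroundedL-before≢0 : ∀ p → EvenGroundedL (p ++ c ∷ q) → c ≢ 0 → ∃ λ p′ → p ≡ p′ ∷ʳ 0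
evenGroundedL-before≢0 []          (c≡0 , _)      c≢0 = contradiction c≡0 c≢0
evenGroundedL-before≢0 (d ∷ [])    (d≡0 , _)      _   = [] , cong [_] d≡0
evenGroundedL-before≢0 (d ∷ e ∷ p) (_ , _ , rest) c≢0 with evenGroundedL-before≢0 p rest c≢0
... | p′ , refl = d ∷ e ∷ p′ , refl

-- The hypothesis EvenGroundedL (v ∷ʳ 0) says that v is even-grounded of even length.
-- In a square (y₀ 0)(y₀ 0) closing v 0, y₀ starts with a nonzero letter, so the letter before
-- the square is 0; shifting by one gives the square (0 y₀)(0 y₀) at the end of v.
evenGroundedL-∷ʳ0⇒¬suffixSquare : EvenGroundedL (v ∷ʳ 0) → ¬ SuffixSquare v → ¬ SuffixSquare (v ∷ʳ 0)
evenGroundedL-∷ʳ0⇒¬suffixSquare {v} eg v-safe (a , y , y≢[] , eq) with suffixSquare-∷ʳ⁻ a y y≢[] eq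
... | [] , refl , _ = evenGroundedL-after0 a (subst EvenGroundedL eq eg) refl
... | e ∷ y₁ , refl , refl with evenGroundedL-after0 (a ++ e ∷ y₁) (subst EvenGroundedL reassoc eg)
  where
  reassoc : v ∷ʳ 0 ≡ (a ++ e ∷ y₁) ++ 0 ∷ e ∷ y₁ ∷ʳ 0
  reassoc = trans eq (trans (cong (λ s → a ++ e ∷ s) (++-assoc y₁ [ 0 ] _)) (sym (++-assoc a (e ∷ y₁) _)))
... | e≢0 with evenGroundedL-before≢0 a (subst EvenGroundedL eq eg) e≢0
... | a₀ , refl = v-safe (a₀ , 0 ∷ e ∷ y₁ , (λ ()) ,
  trans (++-assoc a₀ [ 0 ] _) (cong (λ s → a₀ ++ 0 ∷ e ∷ s) (++-assoc y₁ [ 0 ] _)))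

evenGroundedL-∷ʳ-least : EvenGroundedL v → ¬ SuffixSquare v → ¬ SuffixSquare (v ∷ʳ c) →
                         (0 < c → SuffixSquare (v ∷ʳ 0)) → EvenGroundedL (v ∷ʳ c)
evenGroundedL-∷ʳ-least {v} {c} eg v-safe vc-safe least with evenGroundedL-∷ʳ v eg | c
... | inj₁ eg0 | zero  = eg0
... | inj₁ eg0 | suc _ = contradiction (least z<s) (evenGroundedL-∷ʳ0⇒¬suffixSquare eg0 v-safe)
... | inj₂ nz  | suc _ = nz _ λ ()
... | inj₂ nz  | zero with evenGroundedL-before≢0 v (nz 1 (λ ())) (λ ())
...   | v′ , refl = contradiction (v′ , [ 0 ] , (λ ()) , ++-assoc v′ [ 0 ] [ 0 ]) vc-safe

prefixes⇒evenGrounded∞ : (∀ n → EvenGroundedL (applyUpTo x n)) → EvenGrounded∞ x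
prefixes⇒evenGrounded∞ eg zero with eg 2
... | x₀≡0 , x₁≢0 , _ = x₀≡0 , x₁≢0
prefixes⇒evenGrounded∞ {x} eg (suc k) =
  subst (λ m → (x m ≡ 0) × (x (suc m) ≢ 0)) (sym (*-suc 2 k))
    (prefixes⇒evenGrounded∞ {x ∘ suc ∘ suc} (λ n → proj₂ (proj₂ (eg (suc (suc n))))) k)

isL⇒evenGroundedL : EvenGroundedL w → IsL (inj₁ w) x → SquareFree∞ x → ∀ n → EvenGroundedL (applyUpTo x n)
isL⇒evenGroundedL _ _ _ zero = tt
isL⇒evenGroundedL {w} {x} w-eg isL x-sf (suc j) with j <? length w
... | yes j<w with prefix-extends (applyUpTo x (suc j)) w (prefix-applyUpTo (suc j) x) (proj₁ (proj₁ isL))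
                    (subst (_≤ length w) (sym (length-applyUpTo x (suc j))) j<w)
...   | r , eq = evenGroundedL-++⁻ˡ (applyUpTo x (suc j)) (subst EvenGroundedL eq w-eg)
isL⇒evenGroundedL {w} {x} w-eg isL x-sf (suc j) | no j≮w =
  subst EvenGroundedL (applyUpTo-∷ʳ x j)
    (evenGroundedL-∷ʳ-least (isL⇒evenGroundedL w-eg isL x-sf j) (squareFree∞⇒¬suffixSquare x-sf)
      (subst (λ u → ¬ SuffixSquare u) (sym (applyUpTo-∷ʳ x j)) (squareFree∞⇒¬suffixSquare x-sf))
      (isL⇒greedyFrom w isL j (≮⇒≥ j≮w) 0))

-- Images under a non-erasing morphism

module _ (φ : Morphism) where

  img : ℕ → List ℕ
  img k = toList (φ k)

  img≢[] : ∀ k → img k ≢ []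
  img≢[] k ()

  apply*-++ : ∀ u v → apply* φ (u ++ v) ≡ apply* φ u ++ apply* φ v
  apply*-++ = concatMap-++ img

  apply*-∷ʳ : ∀ u k → apply* φ (u ∷ʳ k) ≡ apply* φ u ++ img k
  apply*-∷ʳ u k = trans (apply*-++ u [ k ]) (cong (apply* φ u ++_) (++-identityʳ (img k)))

  suffixSquare-apply* : SuffixSquare u → SuffixSquare (apply* φ u)
  suffixSquare-apply* (a , []    , y≢[] , _)    = contradiction refl y≢[]
  suffixSquare-apply* (a , k ∷ y , _    , refl) =
    apply* φ a , apply* φ (k ∷ y) , (λ eq → img≢[] k (++-conicalˡ (img k) _ eq)) ,
    trans (apply*-++ a _) (cong (apply* φ a ++_) (apply*-++ (k ∷ y) (k ∷ y)))

  length-apply* : ∀ u → length u ≤ length (apply* φ u)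
  length-apply* []      = z≤n
  length-apply* (k ∷ u) = s≤s (≤-trans (length-apply* u)
    (≤-trans (m≤n+m _ _) (≤-reflexive (sym (length-++ (List⁺.tail (φ k)))))))

  -- apply∞ reads its letters through a helper that Defs keeps private.  `letter x h t i`, letter i of
  -- t followed by the image of x ∘ suc, is bound to that helper by unification with its use below.
  mutual
    private
      letter : Word∞ → ℕ → List ℕ → ℕ → ℕ
      letter x h t i = _

    prefix-image : ∀ x → Prefix u (apply∞ φ (x ∘ suc)) → Prefix (img (x 0) ++ u) (apply∞ φ x)
    prefix-image x pre with φ (x 0)
    ... | h ∷ t = refl , prefix-letter x pre h t

    prefix-letter : ∀ x → Prefix u (apply∞ φ (x ∘ suc)) → ∀ h t → Prefix (t ++ u) (letter x h t)
    prefix-letter x pre h []      = pre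
    prefix-letter x pre h (c ∷ t) = refl , prefix-letter x pre c t

  prefix-apply∞ : ∀ n x → Prefix (apply* φ (applyUpTo x n)) (apply∞ φ x)
  prefix-apply∞ zero    x = tt
  prefix-apply∞ (suc n) x = prefix-image x (prefix-apply∞ n (x ∘ suc))

  length-apply*-applyUpTo : ∀ n x → n ≤ length (apply* φ (applyUpTo x n))
  length-apply*-applyUpTo n x = subst (_≤ length (apply* φ (applyUpTo x n))) (length-applyUpTo x n)
                                  (length-apply* (applyUpTo x n))

  greedyFrom-apply∞ : ∀ n x → (∀ k → n ≤ k → GreedyAfter (apply* φ (applyUpTo x k)) (img (x k))) →
                      GreedyFrom (length (apply* φ (applyUpTo x n))) (apply∞ φ x)
  greedyFrom-apply∞ n x blocks i ℓₙ≤i =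
    greedyBelow (suc i) (≤-trans (length-apply*-applyUpTo n x) (≤-trans ℓₙ≤i (n≤1+n i)))
                (length-apply*-applyUpTo (suc i) x)
    where
    ℓ : ℕ → ℕ
    ℓ k = length (apply* φ (applyUpTo x k))
    greedyBelow : ∀ k → n ≤ k → i < ℓ k → Greedy (apply∞ φ x) i
    greedyBelow zero    _   ()
    greedyBelow (suc k) n≤k+1 i<ℓ with n ≤? k | i <? ℓ k
    ... | yes n≤k | yes i<ℓₖ = greedyBelow k n≤k i<ℓₖ
    ... | yes n≤k | no  i≮ℓₖ = greedyAfter⇒greedy _ (img (x k)) (blocks k n≤k) block-prefix i (≮⇒≥ i≮ℓₖ)
                                 (subst (λ w → i < length w) block i<ℓ)
      where
      block : apply* φ (applyUpTo x (suc k)) ≡ apply* φ (applyUpTo x k) ++ img (x k)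
      block = trans (cong (apply* φ) (sym (applyUpTo-∷ʳ x k))) (apply*-∷ʳ (applyUpTo x k) (x k))
      block-prefix : Prefix (apply* φ (applyUpTo x k) ++ img (x k)) (apply∞ φ x)
      block-prefix = subst (λ w → Prefix w (apply∞ φ x)) block (prefix-apply∞ (suc k) x)
    ... | no  n≰k | _ = contradiction i<ℓ (≤⇒≯ (subst (λ m → ℓ m ≤ i) (≤-antisym n≤k+1 (≰⇒> n≰k)) ℓₙ≤i))

  apply∞-cong : (∀ i → z i ≡ x i) → ∀ i → apply∞ φ z i ≡ apply∞ φ x i
  apply∞-cong {z} {x} z≗x i =
    prefix-agree {x = apply∞ φ z} {z = apply∞ φ x} (apply* φ (applyUpTo z (suc i))) (prefix-apply∞ (suc i) z)
      (subst (λ u → Prefix (apply* φ u) (apply∞ φ x)) (applyUpTo-agree (suc i) λ j _ → sym (z≗x j))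
             (prefix-apply∞ (suc i) x))
      (length-apply*-applyUpTo (suc i) z)

-- The L-commuting property

module _ (φ : Morphism)
         (gen-01 : Generates (apply* φ (0 ∷ [])) (apply* φ (0 ∷ 1 ∷ [])))
         (gen-0n0 : ∀ n → 0 < n → Generates (apply* φ (0 ∷ n ∷ [])) (apply* φ (0 ∷ n ∷ 0 ∷ [])))
         (gen-0n⁺ : ∀ n → 0 < n → Generates ((apply* φ (0 ∷ n ∷ [])) ⁺) (apply* φ (0 ∷ suc n ∷ [])))
         where

  greedyAfter-img0 : ∀ t → 0 < n → GreedyAfter (apply* φ (t ++ 0 ∷ n ∷ [])) (img φ 0)
  greedyAfter-img0 {n} t 0<n =
    subst (λ w → GreedyAfter w (img φ 0)) (sym (apply*-++ φ t (0 ∷ n ∷ [])))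
      (greedyAfter-++ˡ (apply* φ t) _ (img φ 0)
        (generates⇒greedyAfter _ (img φ 0) (gen-0n0 n 0<n) (apply*-∷ʳ φ (0 ∷ n ∷ []) 0)))

  img-suc-split : ∀ n A c → 0 < n → img φ n ≡ A ∷ʳ c →
                  ∃ λ s → img φ (suc n) ≡ (A ∷ʳ suc c) ++ s × GreedyAfter (img φ 0 ++ A ∷ʳ suc c) s
  img-suc-split n A c 0<n img≡ with gen-0n⁺ n 0<n
  ... | gen@((s , gen≡) , _) =
    s , img-next , subst (λ w → GreedyAfter w s) P⁺≡ (generates⇒greedyAfter P⁺ s gen gen≡)
    where
    open ≡-Reasoning
    pair : ∀ k → apply* φ (0 ∷ k ∷ []) ≡ img φ 0 ++ img φ k
    pair k = cong (img φ 0 ++_) (++-identityʳ (img φ k))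
    P⁺ : List ℕ
    P⁺ = apply* φ (0 ∷ n ∷ []) ⁺
    P⁺≡ : P⁺ ≡ img φ 0 ++ A ∷ʳ suc c
    P⁺≡ = begin
      apply* φ (0 ∷ n ∷ []) ⁺   ≡⟨ cong _⁺ (trans (pair n) (cong (img φ 0 ++_) img≡)) ⟩
      (img φ 0 ++ A ∷ʳ c) ⁺      ≡⟨ cong _⁺ (++-assoc (img φ 0) A [ c ]) ⟨
      ((img φ 0 ++ A) ∷ʳ c) ⁺    ≡⟨ ∷ʳ-⁺ (img φ 0 ++ A) ⟩
      (img φ 0 ++ A) ∷ʳ suc c    ≡⟨ ++-assoc (img φ 0) A [ suc c ] ⟩
      img φ 0 ++ A ∷ʳ suc c      ∎
    img-next : img φ (suc n) ≡ (A ∷ʳ suc c) ++ s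
    img-next = ++-cancelˡ (img φ 0) _ _ (begin
      img φ 0 ++ img φ (suc n)     ≡⟨ pair (suc n) ⟨
      apply* φ (0 ∷ suc n ∷ [])    ≡⟨ gen≡ ⟩
      P⁺ ++ s                     ≡⟨ cong (_++ s) P⁺≡ ⟩
      (img φ 0 ++ A ∷ʳ suc c) ++ s ≡⟨ ++-assoc (img φ 0) _ s ⟩
      img φ 0 ++ (A ∷ʳ suc c) ++ s ∎)

  greedyAfter-img-suc : ∀ n t → (∀ d → d < n → SuffixSquare (t ∷ʳ 0 ∷ʳ suc d)) →
                   GreedyAfter (apply* φ (t ∷ʳ 0)) (img φ (suc n))
  greedyAfter-img-suc zero t _ =
    subst (λ w → GreedyAfter w (img φ 1)) (sym (apply*-++ φ t [ 0 ]))
      (greedyAfter-++ˡ (apply* φ t) _ (img φ 1)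
        (generates⇒greedyAfter _ (img φ 1) gen-01 (apply*-∷ʳ φ [ 0 ] 1)))
  greedyAfter-img-suc (suc m) t squares with ∷ʳ-view (img φ (suc m)) (img≢[] φ (suc m))
  ... | A , c , img≡ with img-suc-split (suc m) A c z<s img≡
  ... | s , img-next , after =
    subst (GreedyAfter C) (sym img-next) (greedyAfter-++ C (A ∷ʳ suc c) bumped after′)
    where
    C : List ℕ
    C = apply* φ (t ∷ʳ 0)
    square : SuffixSquare ((C ++ A) ∷ʳ c)
    square = subst SuffixSquare
      (trans (apply*-∷ʳ φ (t ∷ʳ 0) (suc m)) (trans (cong (C ++_) img≡) (sym (++-assoc C A [ c ]))))
      (suffixSquare-apply* φ (squares m (n<1+n m)))
    bumped : GreedyAfter C (A ∷ʳ suc c)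
    bumped = greedyAfter-bump C A
      (subst (GreedyAfter C) img≡ (greedyAfter-img-suc m t λ d d<m → squares d (m<n⇒m<1+n d<m))) square
    after′ : GreedyAfter (C ++ A ∷ʳ suc c) s
    after′ = subst (λ w → GreedyAfter w s)
      (trans (sym (++-assoc (apply* φ t) (img φ 0) _)) (cong (_++ A ∷ʳ suc c) (sym (apply*-∷ʳ φ t 0))))
      (greedyAfter-++ˡ (apply* φ t) _ s after)

  greedyAfter-block : ∀ v c → v ≢ [] → EvenGroundedL (v ∷ʳ c) → (∀ d → d < c → SuffixSquare (v ∷ʳ d)) →
                      GreedyAfter (apply* φ v) (img φ c)
  greedyAfter-block v (suc n) _ eg least with evenGroundedL-before≢0 v eg (λ ())
  ... | t , refl = greedyAfter-img-suc n t (λ d d<n → least (suc d) (s≤s d<n))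
  greedyAfter-block v zero v≢[] eg _ with ∷ʳ-view v v≢[]
  ... | v′ , zero  , refl =
    contradiction refl (evenGroundedL-after0 v′ (subst EvenGroundedL (++-assoc v′ [ 0 ] [ 0 ]) eg))
  ... | v′ , suc m , refl
    with evenGroundedL-before≢0 v′ (subst EvenGroundedL (++-assoc v′ [ suc m ] [ 0 ]) eg) (λ ())
  ...   | t , refl = subst (λ u → GreedyAfter (apply* φ u) (img φ 0)) (sym (++-assoc t [ 0 ] [ suc m ]))
                       (greedyAfter-img0 t z<s)

  L-commutes : (∀ x → InΣ (inj₂ x) → SquareFree∞ (apply∞ φ x)) →
               ∀ w → InΣ (inj₁ w) → IsL (inj₁ w) x → IsL (inj₁ (apply* φ w)) (apply∞ φ x)
  L-commutes _ [] (w≢[] , _) _ = contradiction refl w≢[]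
  L-commutes {x} image-sf w@(_ ∷ _) (_ , w-eg , w-sf) isL@((pw , only) , _) =
    (W-prefix , λ a y y≢[] pre → contradiction (a , y , y≢[] , pre) Y-sf) ,
    greedy⇒least {x = apply∞ φ x} W-prefix Y-greedy
    where
    x-sf : SquareFree∞ x
    x-sf = admissible⇒squareFree∞ w-sf (pw , only)
    x-eg : ∀ n → EvenGroundedL (applyUpTo x n)
    x-eg = isL⇒evenGroundedL w-eg isL x-sf
    Y-sf : SquareFree∞ (apply∞ φ x)
    Y-sf = image-sf x (prefixes⇒evenGrounded∞ x-eg , x-sf)
    W-prefix : Prefix (apply* φ w) (apply∞ φ x)
    W-prefix = subst (λ u → Prefix (apply* φ u) (apply∞ φ x)) (prefix⇒applyUpTo {x = x} w pw)
                 (prefix-apply∞ φ (length w) x)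
    block : ∀ k → length w ≤ k → GreedyAfter (apply* φ (applyUpTo x k)) (img φ (x k))
    block (suc k) w≤k = greedyAfter-block (applyUpTo x (suc k)) (x (suc k)) (λ ())
                          (subst EvenGroundedL (sym (applyUpTo-∷ʳ x (suc k))) (x-eg (suc (suc k))))
                          (isL⇒greedyFrom {x = x} w isL (suc k) w≤k)
    Y-greedy : GreedyFrom (length (apply* φ w)) (apply∞ φ x)
    Y-greedy = subst (λ u → GreedyFrom (length (apply* φ u)) (apply∞ φ x)) (prefix⇒applyUpTo {x = x} w pw)
                 (greedyFrom-apply∞ φ (length w) x block)

theorem4p2 : (φ : Morphism) →
    (∀ w → InΣ w → SquareFree (applyW φ w)) →
    Generates (apply* φ (0 ∷ [])) (apply* φ (0 ∷ 1 ∷ [])) →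
    (∀ n → 0 < n → Generates (apply* φ (0 ∷ n ∷ [])) (apply* φ (0 ∷ n ∷ 0 ∷ []))) →
    (∀ n → 0 < n → Generates ((apply* φ (0 ∷ n ∷ [])) ⁺) (apply* φ (0 ∷ suc n ∷ []))) →
    ∀ w → InΣ w → ∀ x → IsL w x → IsL (applyW φ w) (apply∞ φ x)
theorem4p2 φ image-sf gen-01 gen-0n0 gen-0n⁺ (inj₁ w) w∈Σ x isL =
  L-commutes φ gen-01 gen-0n0 gen-0n⁺ (λ x → image-sf (inj₂ x)) w w∈Σ isL
theorem4p2 φ _ _ _ _ (inj₂ y) _ _ y≗x = apply∞-cong φ y≗x
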